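{- (i) There is a polynomial $p$ such that every flat $\Delta_0$+Iteration term $t(\overline{v})$ is equivalent to a $\Delta_0$-term $t_0(\overline{v})$ with $|t_0|\leqslant 2^{p(|t|)}$ if the numbers of iterations are written in unary, and with $|t_0|\leqslant 2^{2^{p(|t|)}}$ if they are written in binary. (ii) For every $k\geqslant 1$ there is a polynomial $p$ such that every explicit flat $\Delta_0$+Rec term $t(\overline{v})$ of rank at most $k$ is equivalent to a $\Delta_0$-term $t_0(\overline{v})$ with $|t_0|\leqslant \exp_k(p(|t|))$.
   Context: $\Delta_0$-terms (standard list terms) are built from constant lists (finite, possibly nested lists over urelements and the empty list $nil$), list variables and the functions $head$ (last element, $nil$ for $nil$), $tail$ (remove last element, $nil$ for $nil$), $cons(s,a)$ (append $a$ as new last element), $conc$ (concatenation), interpreted in hereditarily finite list superstructures $HW(\mathcal{M})$; $\sqsubseteq$ is the initial-segment relation. Iterative terms: for terms $f(\overline{v}),h(\overline{v},y)$ and a natural number $i$ (unary or binary), $<i>Iter[f,h](\overline{v})$ has value $g^i(\overline{v})$ with $g^0=f(\overline{v})$, $g^{j+1}=h(\overline{v},g^j)$. Recursive terms: for terms $f(\overline{v}),h(\overline{v},y,z),t(\overline{v})$, $Rec[f,h,t](\overline{v})$ has value $g(\overline{v},t)$ with $g(\overline{v},nil)=f(\overline{v})$, $g(\overline{v},cons(\alpha,b))=h(\overline{v},g(\overline{v},\alpha),b)$ for $cons(\alpha,b)\sqsubseteq t$. A term is flat if in every iterative term $<i>Iter[f,h]$ (resp. recursive term $Rec[f,h,t]$)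 occurring in it, $f$ and $h$ are $\Delta_0$-terms; a $\Delta_0$+Rec term is explicit if in every recursive term $Rec[f,h,t]$ occurring in it, $t$ is variable-free. Rank: $\Delta_0$-terms have rank $0$; $Rec[f,h,t]$ has rank $1+\max$ of the ranks of $f,h,t$; any other term has the maximum rank of the recursive terms occurring in it. Terms $s(\overline{v}),t(\overline{v})$ are equivalent if $s(\overline{a})=t(\overline{a})$ in every $HW(\mathcal{M})$ for every assignment $\overline{a}$. $|t|$ is the length of the string representing $t$. $\exp_1(n)=2^n$, $\exp_{k+1}(n)=2^{\exp_k(n)}$. -}

module Defs where

open import Data.Nat using (ℕ; zero; suc; _+_; _*_; _^_; _≤_; _<_; _⊔_)
open import Data.Nat.Logarithm using (⌊log₂_⌋)
open import Data.List using (List; []; _∷_)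
open import Data.Unit using (⊤)
open import Data.Empty using (⊥)
open import Data.Product using (_×_; Σ-syntax)
open import Function.Definitions using (Injective)
open import Relation.Binary.PropositionalEquality using (_≡_)

-- Hereditarily finite list superstructure HW(M) over urelements M.
-- Lists are snoc-lists: `snoc l a` = cons(l,a) appends a as LAST element.

mutual
  data El (M : Set) : Set where
    ur  : M → El M
    lst : HL M → El M

  data HL (M : Set) : Set where
    nil  : HL M
    snoc : HL M → El M → HL M

-- Convention: an urelement used where a list is expected is read as nil.
asList : {M : Set} → El M → HL M
asList (ur _)  = nil
asList (lst l) = l

_++ᴴ_ : {M : Set} → HL M → HL M → HL M
l ++ᴴ nil      = l
l ++ᴴ snoc r a = snoc (l ++ᴴ r) a

headᴱ : {M : Set} → El M → El M
headᴱ x with asList x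
... | nil      = lst nil
... | snoc _ a = a

tailᴱ : {M : Set} → El M → El M
tailᴱ x with asList x
... | nil      = lst nil
... | snoc l _ = lst l

consᴱ : {M : Set} → El M → El M → El M
consᴱ s a = lst (snoc (asList s) a)

concᴱ : {M : Set} → El M → El M → El M
concᴱ s r = lst (asList s ++ᴴ asList r)

mutual
  mapEl : {U M : Set} → (U → M) → El U → El M
  mapEl e (ur u)  = ur (e u)
  mapEl e (lst l) = lst (mapHL e l)

  mapHL : {U M : Set} → (U → M) → HL U → HL M
  mapHL e nil        = nil
  mapHL e (snoc l a) = snoc (mapHL e l) (mapEl e a)

-- Variables are de Bruijn-style indices:
--  * in  iter i f h : f is in the outer scope; in h, var 0 = y and
--    var (suc n) = outer var n.
--  * in  rec f h t  : f and t are in the outer scope; in h, var 0 = y,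
--    var 1 = z and var (suc (suc n)) = outer var n.

data Term (U : Set) : Set where
  var   : ℕ → Term U
  const : HL U → Term U
  head  : Term U → Term U
  tail  : Term U → Term U
  cons  : Term U → Term U → Term U
  conc  : Term U → Term U → Term U
  iter  : ℕ → Term U → Term U → Term U
  rec   : Term U → Term U → Term U → Term U

Env : Set → Set
Env M = ℕ → El M

_∷ᵉ_ : {M : Set} → El M → Env M → Env M
(x ∷ᵉ ρ) zero    = x
(x ∷ᵉ ρ) (suc n) = ρ n

iterate : {M : Set} → ℕ → El M → (El M → El M) → El M
iterate zero    g₀ step = g₀
iterate (suc i) g₀ step = step (iterate i g₀ step)

recList : {M : Set} → El M → (El M → El M → El M) → HL M → El M
recList base step nil        = base
recList base step (snoc α b) = step (recList base step α) b

eval : {U M : Set} → (U → M) → Term U → Env M → El M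
eval e (var n)      ρ = ρ n
eval e (const c)    ρ = lst (mapHL e c)
eval e (head t)     ρ = headᴱ (eval e t ρ)
eval e (tail t)     ρ = tailᴱ (eval e t ρ)
eval e (cons s a)   ρ = consᴱ (eval e s ρ) (eval e a ρ)
eval e (conc s r)   ρ = concᴱ (eval e s ρ) (eval e r ρ)
eval e (iter i f h) ρ = iterate i (eval e f ρ) (λ y → eval e h (y ∷ᵉ ρ))
eval e (rec f h t)  ρ =
  recList (eval e f ρ) (λ y z → eval e h (y ∷ᵉ (z ∷ᵉ ρ))) (asList (eval e t ρ))

-- s and t are equivalent: equal values in every HW(M) (M containing the
-- urelements of the constants) under every assignment of lists to the
-- list variables.
Equivalent : {U : Set} → Term U → Term U → Set₁
Equivalent {U} s t =
  (M : Set) (e : U → M) → Injective _≡_ _≡_ e →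
  (ρ : ℕ → HL M) →
  eval e s (λ n → lst (ρ n)) ≡ eval e t (λ n → lst (ρ n))

IsΔ₀ : {U : Set} → Term U → Set
IsΔ₀ (var _)      = ⊤
IsΔ₀ (const _)    = ⊤
IsΔ₀ (head t)     = IsΔ₀ t
IsΔ₀ (tail t)     = IsΔ₀ t
IsΔ₀ (cons s t)   = IsΔ₀ s × IsΔ₀ t
IsΔ₀ (conc s t)   = IsΔ₀ s × IsΔ₀ t
IsΔ₀ (iter _ _ _) = ⊥
IsΔ₀ (rec _ _ _)  = ⊥

-- Δ₀+Iteration terms: no recursive subterms
NoRec : {U : Set} → Term U → Set
NoRec (var _)      = ⊤
NoRec (const _)    = ⊤
NoRec (head t)     = NoRec t
NoRec (tail t)     = NoRec t
NoRec (cons s t)   = NoRec s × NoRec t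
NoRec (conc s t)   = NoRec s × NoRec t
NoRec (iter _ f h) = NoRec f × NoRec h
NoRec (rec _ _ _)  = ⊥

-- Δ₀+Rec terms: no iterative subterms
NoIter : {U : Set} → Term U → Set
NoIter (var _)      = ⊤
NoIter (const _)    = ⊤
NoIter (head t)     = NoIter t
NoIter (tail t)     = NoIter t
NoIter (cons s t)   = NoIter s × NoIter t
NoIter (conc s t)   = NoIter s × NoIter t
NoIter (iter _ _ _) = ⊥
NoIter (rec f h t)  = NoIter f × NoIter h × NoIter t

Flat : {U : Set} → Term U → Set
Flat (var _)      = ⊤
Flat (const _)    = ⊤
Flat (head t)     = Flat t
Flat (tail t)     = Flat t
Flat (cons s t)   = Flat s × Flat t
Flat (conc s t)   = Flat s × Flat t
Flat (iter _ f h) = IsΔ₀ f × IsΔ₀ h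
Flat (rec f h t)  = IsΔ₀ f × IsΔ₀ h × Flat t

ClosedAt : {U : Set} → ℕ → Term U → Set
ClosedAt d (var n)      = n < d
ClosedAt d (const _)    = ⊤
ClosedAt d (head t)     = ClosedAt d t
ClosedAt d (tail t)     = ClosedAt d t
ClosedAt d (cons s t)   = ClosedAt d s × ClosedAt d t
ClosedAt d (conc s t)   = ClosedAt d s × ClosedAt d t
ClosedAt d (iter _ f h) = ClosedAt d f × ClosedAt (suc d) h
ClosedAt d (rec f h t)  =
  ClosedAt d f × ClosedAt (suc (suc d)) h × ClosedAt d t

VariableFree : {U : Set} → Term U → Set
VariableFree = ClosedAt 0

Explicit : {U : Set} → Term U → Set
Explicit (var _)      = ⊤
Explicit (const _)    = ⊤
Explicit (head t)     = Explicit t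
Explicit (tail t)     = Explicit t
Explicit (cons s t)   = Explicit s × Explicit t
Explicit (conc s t)   = Explicit s × Explicit t
Explicit (iter _ f h) = Explicit f × Explicit h
Explicit (rec f h t)  = Explicit f × Explicit h × Explicit t × VariableFree t

rank : {U : Set} → Term U → ℕ
rank (var _)      = 0
rank (const _)    = 0
rank (head t)     = rank t
rank (tail t)     = rank t
rank (cons s t)   = rank s ⊔ rank t
rank (conc s t)   = rank s ⊔ rank t
rank (iter _ f h) = rank f ⊔ rank h
rank (rec f h t)  = suc (rank f ⊔ rank h ⊔ rank t)

-- Length of the string representing a term.
-- `numLen i` = length of the numeral written for the iteration count i.

unaryLen : ℕ → ℕ
unaryLen i = i

binaryLen : ℕ → ℕ
binaryLen i = suc ⌊log₂ i ⌋

mutual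
  -- written as "nil" / "<a1,...,an>"; urelements are single symbols
  sizeHL : {U : Set} → HL U → ℕ
  sizeHL nil        = 2
  sizeHL (snoc l a) = sizeHL l + sizeEl a + 1

  sizeEl : {U : Set} → El U → ℕ
  sizeEl (ur _)  = 1
  sizeEl (lst l) = sizeHL l

size : {U : Set} → (ℕ → ℕ) → Term U → ℕ
size numLen (var _)      = 1
size numLen (const c)    = sizeHL c
size numLen (head t)     = 3 + size numLen t
size numLen (tail t)     = 3 + size numLen t
size numLen (cons s t)   = 4 + size numLen s + size numLen t
size numLen (conc s t)   = 4 + size numLen s + size numLen t
size numLen (iter i f h) = 8 + numLen i + size numLen f + size numLen h
size numLen (rec f h t)  = 8 + size numLen f + size numLen h + size numLen t

Poly : Set
Poly = List ℕ

evalPoly : Poly → ℕ → ℕ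
evalPoly []       n = 0
evalPoly (a ∷ as) n = a + n * evalPoly as n

exp : ℕ → ℕ → ℕ
exp zero    n = n
exp (suc k) n = 2 ^ exp k n

module Submission where

-- Both unfoldings are iterated simultaneous substitution into the Δ₀-term h:
-- <i>Iter[f,h] is h substituted into itself i times starting from f, and
-- Rec[f,h,t] with variable-free t is h substituted along the value of t.
-- As substituting terms of size ≤ K into h gives size ≤ |h|·K, i iterations
-- cost 2^(|h|·i+|f|) and recursion along a list of size s costs
-- 2^((|h|+3)·s+|f|).  The value of t in Rec[f,h,t]
-- is bounded through its own translation of lower rank: induction on rank.

open import Defs
open import Data.Nat using (ℕ; _≤_; _^_)
open import Data.Product using (_×_; Σ-syntax)
open import Data.Nat using (zero; suc; _+_; _*_; _<_; _∸_; _⊔_; z≤n; s≤s; ⌊_/2⌋)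
open import Data.Nat.Properties
open import Data.Nat.Tactic.RingSolver using (solve-∀)
open import Data.Nat.Logarithm using (⌊log₂_⌋; ⌊log₂⌋-mono-≤; ⌊log₂⌊n/2⌋⌋≡⌊log₂n⌋∸1)
open import Data.Nat.Induction using (<-rec)
open import Data.Product using (_,_)
open import Data.Sum using (inj₁; inj₂)
open import Data.Unit using (tt)
open import Data.List using (_∷_; [])
open import Function.Base using (id)
open import Relation.Binary.PropositionalEquality
  using (_≡_; refl; sym; trans; cong; cong₂; subst; subst₂)

≤-by : ∀ {a b} d → a + d ≡ b → a ≤ b
≤-by {a} d eq = subst (a ≤_) eq (m≤m+n a d)

1≤2^ : ∀ n → 1 ≤ 2 ^ n
1≤2^ = m^n>0 2

2^-mono : ∀ {x y} → x ≤ y → 2 ^ x ≤ 2 ^ y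
2^-mono = ^-monoʳ-≤ 2

n<2^n : ∀ n → n < 2 ^ n
n<2^n zero    = s≤s z≤n
n<2^n (suc n) = begin-strict
  suc n           ≡⟨ +-comm 1 n ⟩
  n + 1           <⟨ +-mono-≤ (n<2^n n) (1≤2^ n) ⟩
  2 ^ n + 2 ^ n   ≡⟨ cong (2 ^ n +_) (sym (+-identityʳ (2 ^ n))) ⟩
  2 ^ suc n       ∎
  where open ≤-Reasoning

2^-+ : ∀ x y → 2 ^ x * 2 ^ y ≡ 2 ^ (x + y)
2^-+ x y = sym (^-distribˡ-+-* 2 x y)

exp-mono : ∀ r {x y} → x ≤ y → exp r x ≤ exp r y
exp-mono zero    x≤y = x≤y
exp-mono (suc r) x≤y = 2^-mono (exp-mono r x≤y)

n≤exp : ∀ r n → n ≤ exp r n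
n≤exp zero    n = ≤-refl
n≤exp (suc r) n = ≤-trans (n≤exp r n) (<⇒≤ (n<2^n (exp r n)))

4ab≤[a+b]²-ordered : ∀ {a b} → a ≤ b → 4 * a * b ≤ (a + b) * (a + b)
4ab≤[a+b]²-ordered {a} {b} a≤b =
  subst (λ b → 4 * a * b ≤ (a + b) * (a + b)) (m+[n∸m]≡n a≤b)
        (≤-by ((b ∸ a) * (b ∸ a)) (gap a (b ∸ a)))
  where
  gap : ∀ a d → 4 * a * (a + d) + d * d ≡ (a + (a + d)) * (a + (a + d))
  gap = solve-∀

4ab≤[a+b]² : ∀ a b → 4 * a * b ≤ (a + b) * (a + b)
4ab≤[a+b]² a b with ≤-total a b
... | inj₁ a≤b = 4ab≤[a+b]²-ordered a≤b
... | inj₂ b≤a = subst₂ _≤_ (swap b a) (swap² b a) (4ab≤[a+b]²-ordered b≤a)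
  where
  swap : ∀ x y → 4 * x * y ≡ 4 * y * x
  swap = solve-∀
  swap² : ∀ x y → (x + y) * (x + y) ≡ (y + x) * (y + x)
  swap² = solve-∀

2^+2^≤ : ∀ x y → 2 ^ x + 2 ^ y + 4 ≤ 2 ^ (x + y + 4)
2^+2^≤ x y = begin
  2 ^ x + 2 ^ y + 4        ≤⟨ sum≤product (2 ^ x) (2 ^ y) (1≤2^ x) (1≤2^ y) ⟩
  2 ^ x * 2 ^ y * 2 ^ 4    ≡⟨ cong (_* 2 ^ 4) (2^-+ x y) ⟩
  2 ^ (x + y) * 2 ^ 4      ≡⟨ 2^-+ (x + y) 4 ⟩
  2 ^ (x + y + 4)          ∎
  where
  open ≤-Reasoning
  sum≤product : ∀ a b → 1 ≤ a → 1 ≤ b → a + b + 4 ≤ a * b * 16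
  sum≤product (suc a) (suc b) _ _ = ≤-by (10 + 15 * a + 15 * b + 16 * a * b) (identity a b)
    where
    identity : ∀ a b →
      suc a + suc b + 4 + (10 + 15 * a + 15 * b + 16 * a * b) ≡ suc a * suc b * 16
    identity = solve-∀

exp-sum : ∀ r x y → exp r x + exp r y + 4 ≤ exp r (x + y + 4)
exp-sum zero    x y = ≤-refl
exp-sum (suc r) x y = ≤-trans (2^+2^≤ (exp r x) (exp r y)) (2^-mono (exp-sum r x y))

+≤*2^ : ∀ E d → 1 ≤ E → E + d ≤ E * 2 ^ d
+≤*2^ E@(suc _) d _ = begin
  E + d          ≤⟨ +-monoʳ-≤ E (m≤n*m d E) ⟩
  E + E * d      ≡⟨ sym (*-suc E d) ⟩
  E * suc d      ≤⟨ *-monoʳ-≤ E (n<2^n d) ⟩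
  E * 2 ^ d      ∎
  where open ≤-Reasoning

exp-shift : ∀ r x d → exp (suc r) x * 2 ^ d ≤ exp (suc r) (x + d)
exp-shift zero    x d = ≤-reflexive (2^-+ x d)
exp-shift (suc r) x d = begin
  2 ^ E * 2 ^ d        ≡⟨ 2^-+ E d ⟩
  2 ^ (E + d)          ≤⟨ 2^-mono (+≤*2^ E d (1≤2^ (exp r x))) ⟩
  2 ^ (E * 2 ^ d)      ≤⟨ 2^-mono (exp-shift r x d) ⟩
  2 ^ exp (suc r) (x + d) ∎
  where
  open ≤-Reasoning
  E = exp (suc r) x

-- B bounds a size-increasing map on terms that is homomorphic on head,
-- tail, cons and conc (these add 3 resp. 4 symbols to the size).
record SizeBound (B : ℕ → ℕ) : Set where
  field
    n≤B    : ∀ n → n ≤ B n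
    unary  : ∀ a → 3 + B a ≤ B (3 + a)
    binary : ∀ a b → 4 + B a + B b ≤ B (4 + a + b)

  unary-step : ∀ {a x} → x ≤ B a → 3 + x ≤ B (3 + a)
  unary-step {a} x≤ = ≤-trans (+-monoʳ-≤ 3 x≤) (unary a)

  binary-step : ∀ {a b x y} → x ≤ B a → y ≤ B b → 4 + x + y ≤ B (4 + a + b)
  binary-step {a} {b} x≤ y≤ = ≤-trans (+-mono-≤ (+-monoʳ-≤ 4 x≤) y≤) (binary a b)

rankBound : ℕ → ℕ → ℕ
rankBound zero    n = 2 * n
rankBound (suc r) n = exp (suc r) (n * n)

rankBound-sizeBound : ∀ r → SizeBound (rankBound r)
rankBound-sizeBound zero = record
  { n≤B    = λ n → m≤m+n n (n + 0)
  ; unary  = λ a → ≤-by 3 (unaryEq a)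
  ; binary = λ a b → ≤-by 4 (binaryEq a b)
  }
  where
  unaryEq : ∀ a → 3 + 2 * a + 3 ≡ 2 * (3 + a)
  unaryEq = solve-∀
  binaryEq : ∀ a b → 4 + 2 * a + 2 * b + 4 ≡ 2 * (4 + a + b)
  binaryEq = solve-∀
rankBound-sizeBound (suc r) = record
  { n≤B    = λ n → ≤-trans (n≤n*n n) (n≤exp (suc r) (n * n))
  ; unary  = unary
  ; binary = binary
  }
  where
  open ≤-Reasoning
  T = exp (suc r)
  n≤n*n : ∀ n → n ≤ n * n
  n≤n*n zero      = z≤n
  n≤n*n n@(suc _) = m≤m*n n n
  unary : ∀ a → 3 + T (a * a) ≤ T ((3 + a) * (3 + a))
  unary a = begin
    3 + T (a * a)               ≤⟨ ≤-by (T 0 + 1) (rearrange (T (a * a)) (T 0)) ⟩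
    T (a * a) + T 0 + 4         ≤⟨ exp-sum (suc r) (a * a) 0 ⟩
    T (a * a + 0 + 4)           ≤⟨ exp-mono (suc r) (≤-by (5 + 6 * a) (square a)) ⟩
    T ((3 + a) * (3 + a))       ∎
    where
    rearrange : ∀ x y → 3 + x + (y + 1) ≡ x + y + 4
    rearrange = solve-∀
    square : ∀ a → a * a + 0 + 4 + (5 + 6 * a) ≡ (3 + a) * (3 + a)
    square = solve-∀
  binary : ∀ a b → 4 + T (a * a) + T (b * b) ≤ T ((4 + a + b) * (4 + a + b))
  binary a b = begin
    4 + T (a * a) + T (b * b)   ≡⟨ rearrange (T (a * a)) (T (b * b)) ⟩
    T (a * a) + T (b * b) + 4   ≤⟨ exp-sum (suc r) (a * a) (b * b) ⟩
    T (a * a + b * b + 4)       ≤⟨ exp-mono (suc r) (≤-by (12 + 8 * a + 8 * b + 2 * a * b) (square a b)) ⟩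
    T ((4 + a + b) * (4 + a + b)) ∎
    where
    rearrange : ∀ x y → 4 + x + y ≡ x + y + 4
    rearrange = solve-∀
    square : ∀ a b →
      a * a + b * b + 4 + (12 + 8 * a + 8 * b + 2 * a * b) ≡ (4 + a + b) * (4 + a + b)
    square = solve-∀

module RankBound (r : ℕ) = SizeBound (rankBound-sizeBound r)

-- One more layer of recursion.  Unfolding Rec[f,h,t] along a list of size
-- at most 1 + 2·rankBound r |t| gives an exponent dominated by the
-- exponent of rankBound (suc r) |Rec[f,h,t]|.
rec-exponent : ∀ r f h m →
  (h + 3) * (1 + rankBound r m * 2) + f ≤ exp r ((8 + f + h + m) * (8 + f + h + m))
rec-exponent zero f h m = begin
  (h + 3) * (1 + 2 * m * 2) + f          ≡⟨ split f h m ⟩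
  4 * h * m + (12 * m + h + 3 + f)       ≤⟨ +-mono-≤ (4ab≤[a+b]² h m)
                                              (≤-by (61 + f * f + 15 * f + 15 * h + 4 * m + 2 * f * h + 2 * f * m)
                                                    (rest f h m)) ⟩
  (h + m) * (h + m) + (64 + f * f + 16 * f + 16 * h + 16 * m + 2 * f * h + 2 * f * m)
                                         ≡⟨ square f h m ⟩
  (8 + f + h + m) * (8 + f + h + m)      ∎
  where
  open ≤-Reasoning
  split : ∀ f h m → (h + 3) * (1 + 2 * m * 2) + f ≡ 4 * h * m + (12 * m + h + 3 + f)
  split = solve-∀
  rest : ∀ f h m → 12 * m + h + 3 + f + (61 + f * f + 15 * f + 15 * h + 4 * m + 2 * f * h + 2 * f * m)
                 ≡ 64 + f * f + 16 * f + 16 * h + 16 * m + 2 * f * h + 2 * f * m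
  rest = solve-∀
  square : ∀ f h m →
    (h + m) * (h + m) + (64 + f * f + 16 * f + 16 * h + 16 * m + 2 * f * h + 2 * f * m)
      ≡ (8 + f + h + m) * (8 + f + h + m)
  square = solve-∀
rec-exponent (suc r) f h m = begin
  (h + 3) * (1 + E * 2) + f     ≤⟨ linear E (1≤2^ (exp r (m * m))) ⟩
  E * d                         ≤⟨ *-monoʳ-≤ E (<⇒≤ (n<2^n d)) ⟩
  E * 2 ^ d                     ≤⟨ exp-shift r (m * m) d ⟩
  exp (suc r) (m * m + d)       ≤⟨ exp-mono (suc r) (≤-by (55 + f * f + h * h + 15 * f + 13 * h + 16 * m
                                                            + 2 * f * h + 2 * f * m + 2 * h * m) (square f h m)) ⟩
  exp (suc r) ((8 + f + h + m) * (8 + f + h + m)) ∎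
  where
  open ≤-Reasoning
  E = exp (suc r) (m * m)
  d = 3 * (h + 3) + f
  linear : ∀ E → 1 ≤ E → (h + 3) * (1 + E * 2) + f ≤ E * d
  linear (suc e) _ = ≤-by (e * h + 3 * e + e * f) (expand e f h)
    where
    expand : ∀ e f h →
      (h + 3) * (1 + suc e * 2) + f + (e * h + 3 * e + e * f) ≡ suc e * (3 * (h + 3) + f)
    expand = solve-∀
  square : ∀ f h m →
    m * m + (3 * (h + 3) + f)
      + (55 + f * f + h * h + 15 * f + 13 * h + 16 * m + 2 * f * h + 2 * f * m + 2 * h * m)
      ≡ (8 + f + h + m) * (8 + f + h + m)
  square = solve-∀

-- The arithmetic of one unfolding step of a recursion: if the current term
-- has size X ≤ 2^E, substituting it and an element of size s into a
-- Δ₀-term of size H stays below 2^(E + (H+3)(s+1)).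
growth-step : ∀ {X E} H s → X ≤ 2 ^ E → H * (X + s + 6) ≤ 2 ^ (E + (H + 3) * (s + 1))
growth-step {X} {E} H s X≤ = begin
  H * (X + s + 6)                ≤⟨ *-mono-≤ (<⇒≤ (n<2^n H)) summands ⟩
  2 ^ H * (2 ^ E * 2 ^ (s + 3))  ≡⟨ cong (2 ^ H *_) (2^-+ E (s + 3)) ⟩
  2 ^ H * 2 ^ (E + (s + 3))      ≡⟨ 2^-+ H (E + (s + 3)) ⟩
  2 ^ (H + (E + (s + 3)))        ≤⟨ 2^-mono {H + (E + (s + 3))} (≤-by (H * s + 2 * s) (exponent H E s)) ⟩
  2 ^ (E + (H + 3) * (s + 1))    ∎
  where
  open ≤-Reasoning
  exponent : ∀ H E s → H + (E + (s + 3)) + (H * s + 2 * s) ≡ E + (H + 3) * (s + 1)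
  exponent = solve-∀
  absorb : ∀ P → 1 ≤ P → X ≤ P → X + s + 6 ≤ P * (s + 7)
  absorb P@(suc p) _ X≤P = ≤-trans (+-monoˡ-≤ 6 (+-monoˡ-≤ s X≤P)) (≤-by (p * (s + 6)) (expand p s))
    where
    expand : ∀ p s → suc p + s + 6 + p * (s + 6) ≡ suc p * (s + 7)
    expand = solve-∀
  s+7≤ : s + 7 ≤ 2 ^ (s + 3)
  s+7≤ = begin
    s + 7          ≤⟨ ≤-by (7 * s + 1) (expand s) ⟩
    suc s * 8      ≤⟨ *-monoˡ-≤ 8 (n<2^n s) ⟩
    2 ^ s * 2 ^ 3  ≡⟨ 2^-+ s 3 ⟩
    2 ^ (s + 3)    ∎
    where
    expand : ∀ s → s + 7 + (7 * s + 1) ≡ suc s * 8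
    expand = solve-∀
  summands : X + s + 6 ≤ 2 ^ E * 2 ^ (s + 3)
  summands = ≤-trans (absorb (2 ^ E) (1≤2^ E) X≤) (*-monoʳ-≤ (2 ^ E) s+7≤)

growth : {U : Set} (H f : ℕ) (G : HL U → ℕ) → G nil ≤ 2 ^ f →
  (∀ α b → G (snoc α b) ≤ H * (G α + sizeEl b + 6)) →
  ∀ α → G α ≤ 2 ^ ((H + 3) * sizeHL α + f)
growth H f G G-nil G-snoc nil = ≤-trans G-nil (2^-mono (m≤n+m f ((H + 3) * 2)))
growth H f G G-nil G-snoc (snoc α b) = begin
  G (snoc α b)                                   ≤⟨ G-snoc α b ⟩
  H * (G α + s + 6)                              ≤⟨ growth-step {E = (H + 3) * sizeHL α + f} H s
                                                      (growth H f G G-nil G-snoc α) ⟩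
  2 ^ ((H + 3) * sizeHL α + f + (H + 3) * (s + 1)) ≡⟨ cong (2 ^_) (regroup H (sizeHL α) s f) ⟩
  2 ^ ((H + 3) * (sizeHL α + s + 1) + f)         ∎
  where
  open ≤-Reasoning
  s = sizeEl b
  regroup : ∀ H a s f → (H + 3) * a + f + (H + 3) * (s + 1) ≡ (H + 3) * (a + s + 1) + f
  regroup = solve-∀

<2^binaryLen : ∀ i → i < 2 ^ binaryLen i
<2^binaryLen = <-rec (λ i → i < 2 ^ binaryLen i) step
  where
  halves : ∀ j → j ≤ ⌊ j /2⌋ + ⌊ j /2⌋ + 1
  halves zero          = z≤n
  halves (suc zero)    = s≤s z≤n
  halves (suc (suc j)) = subst (suc (suc j) ≤_) (shift ⌊ j /2⌋) (s≤s (s≤s (halves j)))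
    where
    shift : ∀ x → suc (suc (x + x + 1)) ≡ suc x + suc x + 1
    shift = solve-∀
  step : ∀ i → (∀ {j} → j < i → j < 2 ^ binaryLen j) → i < 2 ^ binaryLen i
  step zero          _     = s≤s z≤n
  step (suc zero)    _     = s≤s (s≤s z≤n)
  step i@(suc (suc j)) below = begin-strict
    i                        ≤⟨ halves i ⟩
    ⌊ i /2⌋ + ⌊ i /2⌋ + 1    <⟨ ≤-reflexive (double ⌊ i /2⌋) ⟩
    suc ⌊ i /2⌋ + suc ⌊ i /2⌋ ≤⟨ +-mono-≤ half< half< ⟩
    2 ^ L + 2 ^ L            ≡⟨ cong (2 ^ L +_) (sym (+-identityʳ (2 ^ L))) ⟩
    2 ^ suc L                ∎
    where
    open ≤-Reasoning
    L = ⌊log₂ i ⌋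
    double : ∀ x → suc (x + x + 1) ≡ suc x + suc x
    double = solve-∀
    digits-of-half : binaryLen ⌊ i /2⌋ ≡ L
    digits-of-half = begin-equality
      suc ⌊log₂ ⌊ i /2⌋ ⌋  ≡⟨ cong suc (⌊log₂⌊n/2⌋⌋≡⌊log₂n⌋∸1 i) ⟩
      suc (L ∸ 1)          ≡⟨ +-comm 1 (L ∸ 1) ⟩
      L ∸ 1 + 1            ≡⟨ m∸n+n≡m (⌊log₂⌋-mono-≤ {2} {i} (s≤s (s≤s z≤n))) ⟩
      L                    ∎
    half< : suc ⌊ i /2⌋ ≤ 2 ^ L
    half< = subst (λ k → ⌊ i /2⌋ < 2 ^ k) digits-of-half (below (⌊n/2⌋<n (suc j)))

mutual
  mapEl-id : {U : Set} (v : El U) → mapEl id v ≡ v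
  mapEl-id (ur u)  = refl
  mapEl-id (lst l) = cong lst (mapHL-id l)

  mapHL-id : {U : Set} (l : HL U) → mapHL id l ≡ l
  mapHL-id nil        = refl
  mapHL-id (snoc l a) = cong₂ snoc (mapHL-id l) (mapEl-id a)

module _ {U M : Set} (e : U → M) where

  asList-map : (v : El U) → asList (mapEl e v) ≡ mapHL e (asList v)
  asList-map (ur u)  = refl
  asList-map (lst l) = refl

  head-map : (v : El U) → headᴱ (mapEl e v) ≡ mapEl e (headᴱ v)
  head-map (ur u)           = refl
  head-map (lst nil)        = refl
  head-map (lst (snoc l a)) = refl

  tail-map : (v : El U) → tailᴱ (mapEl e v) ≡ mapEl e (tailᴱ v)
  tail-map (ur u)           = refl
  tail-map (lst nil)        = refl
  tail-map (lst (snoc l a)) = refl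

  cons-map : (s a : El U) → consᴱ (mapEl e s) (mapEl e a) ≡ mapEl e (consᴱ s a)
  cons-map s a = cong (λ l → lst (snoc l (mapEl e a))) (asList-map s)

  ++ᴴ-map : (l r : HL U) → mapHL e l ++ᴴ mapHL e r ≡ mapHL e (l ++ᴴ r)
  ++ᴴ-map l nil        = refl
  ++ᴴ-map l (snoc r a) = cong (λ l′ → snoc l′ (mapEl e a)) (++ᴴ-map l r)

  conc-map : (s r : El U) → concᴱ (mapEl e s) (mapEl e r) ≡ mapEl e (concᴱ s r)
  conc-map s r = trans (cong₂ (λ l l′ → lst (l ++ᴴ l′)) (asList-map s) (asList-map r))
                       (cong lst (++ᴴ-map (asList s) (asList r)))

  recList-map : ∀ {b b′ step step′} (l : HL U) → b ≡ mapEl e b′ →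
    (∀ y z → step (mapEl e y) (mapEl e z) ≡ mapEl e (step′ y z)) →
    recList b step (mapHL e l) ≡ mapEl e (recList b′ step′ l)
  recList-map nil        b≡ step≡ = b≡
  recList-map {step = step} (snoc l a) b≡ step≡ =
    trans (cong (λ y → step y (mapEl e a)) (recList-map l b≡ step≡)) (step≡ _ a)

  iterate-map : ∀ {b b′ step step′} i → b ≡ mapEl e b′ →
    (∀ y → step (mapEl e y) ≡ mapEl e (step′ y)) →
    iterate i b step ≡ mapEl e (iterate i b′ step′)
  iterate-map zero    b≡ step≡ = b≡
  iterate-map {step = step} (suc i) b≡ step≡ = trans (cong step (iterate-map i b≡ step≡)) (step≡ _)

  eval-map : ∀ d (t : Term U) → ClosedAt d t → (ρ : Env M) (ρ′ : Env U) →
    (∀ n → n < d → ρ n ≡ mapEl e (ρ′ n)) →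
    eval e t ρ ≡ mapEl e (eval id t ρ′)
  eval-map d (var n)    n<d ρ ρ′ ρ≡ = ρ≡ n n<d
  eval-map d (const c)  _   ρ ρ′ ρ≡ = cong (λ c′ → lst (mapHL e c′)) (sym (mapHL-id c))
  eval-map d (head t)   c   ρ ρ′ ρ≡ =
    trans (cong headᴱ (eval-map d t c ρ ρ′ ρ≡)) (head-map (eval id t ρ′))
  eval-map d (tail t)   c   ρ ρ′ ρ≡ =
    trans (cong tailᴱ (eval-map d t c ρ ρ′ ρ≡)) (tail-map (eval id t ρ′))
  eval-map d (cons s t) (cs , ct) ρ ρ′ ρ≡ =
    trans (cong₂ consᴱ (eval-map d s cs ρ ρ′ ρ≡) (eval-map d t ct ρ ρ′ ρ≡))
          (cons-map (eval id s ρ′) (eval id t ρ′))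
  eval-map d (conc s t) (cs , ct) ρ ρ′ ρ≡ =
    trans (cong₂ concᴱ (eval-map d s cs ρ ρ′ ρ≡) (eval-map d t ct ρ ρ′ ρ≡))
          (conc-map (eval id s ρ′) (eval id t ρ′))
  eval-map d (iter i f h) (cf , ch) ρ ρ′ ρ≡ =
    iterate-map i (eval-map d f cf ρ ρ′ ρ≡)
      (λ y → eval-map (suc d) h ch (mapEl e y ∷ᵉ ρ) (y ∷ᵉ ρ′)
               (λ { zero _ → refl ; (suc n) (s≤s n<d) → ρ≡ n n<d }))
  eval-map d (rec f h t) (cf , ch , ct) ρ ρ′ ρ≡ =
    trans (cong (recList (eval e f ρ) (λ y z → eval e h (y ∷ᵉ (z ∷ᵉ ρ))))
                (trans (cong asList (eval-map d t ct ρ ρ′ ρ≡)) (asList-map (eval id t ρ′))))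
          (recList-map (asList (eval id t ρ′)) (eval-map d f cf ρ ρ′ ρ≡)
            (λ y z → eval-map (suc (suc d)) h ch (mapEl e y ∷ᵉ (mapEl e z ∷ᵉ ρ)) (y ∷ᵉ (z ∷ᵉ ρ′))
               (λ { zero _ → refl
                  ; (suc zero) _ → refl
                  ; (suc (suc n)) (s≤s (s≤s n<d)) → ρ≡ n n<d })))

mutual
  sizeHL≥2 : {U : Set} (l : HL U) → 2 ≤ sizeHL l
  sizeHL≥2 nil        = ≤-refl
  sizeHL≥2 (snoc l a) = ≤-trans (sizeHL≥2 l) (≤-trans (m≤m+n (sizeHL l) (sizeEl a)) (m≤m+n _ 1))

  sizeEl≥1 : {U : Set} (v : El U) → 1 ≤ sizeEl v
  sizeEl≥1 (ur _)  = ≤-refl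
  sizeEl≥1 (lst l) = ≤-trans (s≤s z≤n) (sizeHL≥2 l)

size≥1 : {U : Set} (nl : ℕ → ℕ) (t : Term U) → 1 ≤ size nl t
size≥1 nl (var _)      = ≤-refl
size≥1 nl (const c)    = ≤-trans (s≤s z≤n) (sizeHL≥2 c)
size≥1 nl (head t)     = s≤s z≤n
size≥1 nl (tail t)     = s≤s z≤n
size≥1 nl (cons s t)   = s≤s z≤n
size≥1 nl (conc s t)   = s≤s z≤n
size≥1 nl (iter i f h) = s≤s z≤n
size≥1 nl (rec f h t)  = s≤s z≤n

mutual
  sizeHL-map : {U M : Set} (e : U → M) (l : HL U) → sizeHL (mapHL e l) ≡ sizeHL l
  sizeHL-map e nil        = refl
  sizeHL-map e (snoc l a) = cong₂ (λ x y → x + y + 1) (sizeHL-map e l) (sizeEl-map e a)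

  sizeEl-map : {U M : Set} (e : U → M) (v : El U) → sizeEl (mapEl e v) ≡ sizeEl v
  sizeEl-map e (ur _)  = refl
  sizeEl-map e (lst l) = sizeHL-map e l

-- each list operation adds at most as much to the size of its arguments
-- as the corresponding term constructor adds to the size of a term
asList-size : {U : Set} (v : El U) → sizeHL (asList v) ≤ 1 + sizeEl v
asList-size (ur _)  = ≤-refl
asList-size (lst l) = n≤1+n _

head-size : {U : Set} (v : El U) → sizeEl (headᴱ v) ≤ 3 + sizeEl v
head-size (ur _)           = s≤s (s≤s z≤n)
head-size (lst nil)        = s≤s (s≤s z≤n)
head-size (lst (snoc l a)) = ≤-trans (m≤n+m (sizeEl a) (sizeHL l)) (≤-trans (m≤m+n _ 1) (m≤n+m _ 3))

tail-size : {U : Set} (v : El U) → sizeEl (tailᴱ v) ≤ 3 + sizeEl v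
tail-size (ur _)           = s≤s (s≤s z≤n)
tail-size (lst nil)        = s≤s (s≤s z≤n)
tail-size (lst (snoc l a)) = ≤-trans (m≤m+n (sizeHL l) (sizeEl a)) (≤-trans (m≤m+n _ 1) (m≤n+m _ 3))

cons-size : {U : Set} (s a : El U) → sizeEl (consᴱ s a) ≤ 4 + sizeEl s + sizeEl a
cons-size s a = ≤-trans (+-monoˡ-≤ 1 (+-monoˡ-≤ (sizeEl a) (asList-size s)))
                        (≤-by 2 (rearrange (sizeEl s) (sizeEl a)))
  where
  rearrange : ∀ x y → 1 + x + y + 1 + 2 ≡ 4 + x + y
  rearrange = solve-∀

++ᴴ-size : {U : Set} (l r : HL U) → sizeHL (l ++ᴴ r) ≤ sizeHL l + sizeHL r
++ᴴ-size l nil        = m≤m+n (sizeHL l) 2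
++ᴴ-size l (snoc r a) = ≤-trans (+-monoˡ-≤ 1 (+-monoˡ-≤ (sizeEl a) (++ᴴ-size l r)))
                                (≤-reflexive (reassoc (sizeHL l) (sizeHL r) (sizeEl a)))
  where
  reassoc : ∀ x y z → x + y + z + 1 ≡ x + (y + z + 1)
  reassoc = solve-∀

conc-size : {U : Set} (s r : El U) → sizeEl (concᴱ s r) ≤ 4 + sizeEl s + sizeEl r
conc-size s r = ≤-trans (++ᴴ-size (asList s) (asList r))
  (≤-trans (+-mono-≤ (asList-size s) (asList-size r)) (≤-by 2 (rearrange (sizeEl s) (sizeEl r))))
  where
  rearrange : ∀ x y → 1 + x + (1 + y) + 2 ≡ 4 + x + y
  rearrange = solve-∀

-- Size arithmetic for a Δ₀-term whose leaves are replaced by objects of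
-- size at most K: every constructor scales by K.
module Scaled {K : ℕ} (1≤K : 1 ≤ K) where

  leaf : ∀ {x} → x ≤ K → x ≤ 1 * K
  leaf {x} x≤K = ≤-trans x≤K (≤-reflexive (sym (*-identityˡ K)))

  constant : ∀ c → c ≤ c * K
  constant c = ≤-trans (≤-reflexive (sym (*-identityʳ c))) (*-monoʳ-≤ c 1≤K)

  unary : ∀ {x} t → x ≤ t * K → 3 + x ≤ (3 + t) * K
  unary t x≤ = ≤-trans (+-mono-≤ (constant 3) x≤) (≤-reflexive (sym (*-distribʳ-+ K 3 t)))

  binary : ∀ {x y} s t → x ≤ s * K → y ≤ t * K → 4 + x + y ≤ (4 + s + t) * K
  binary s t x≤ y≤ =
    ≤-trans (+-mono-≤ (+-mono-≤ (constant 4) x≤) y≤) (≤-reflexive (distrib K s t))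
    where
    distrib : ∀ K s t → 4 * K + s * K + t * K ≡ (4 + s + t) * K
    distrib = solve-∀

value-size : {U M : Set} (e : U → M) (nl : ℕ → ℕ) (h : Term U) → IsΔ₀ h →
  (ρ : Env M) {K : ℕ} → (∀ n → sizeEl (ρ n) ≤ K) → sizeEl (eval e h ρ) ≤ size nl h * K
value-size e nl h Δ₀h ρ {K} ρ≤ = go h Δ₀h
  where
  open Scaled (≤-trans (sizeEl≥1 (ρ 0)) (ρ≤ 0))
  go : (h : Term _) → IsΔ₀ h → sizeEl (eval e h ρ) ≤ size nl h * K
  go (var n)    _         = leaf (ρ≤ n)
  go (const c)  _         = ≤-trans (≤-reflexive (sizeHL-map e c)) (constant (sizeHL c))
  go (head t)   Δ₀t       = ≤-trans (head-size (eval e t ρ)) (unary (size nl t) (go t Δ₀t))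
  go (tail t)   Δ₀t       = ≤-trans (tail-size (eval e t ρ)) (unary (size nl t) (go t Δ₀t))
  go (cons s t) (Δ₀s , Δ₀t) = ≤-trans (cons-size (eval e s ρ) (eval e t ρ))
                                      (binary (size nl s) (size nl t) (go s Δ₀s) (go t Δ₀t))
  go (conc s t) (Δ₀s , Δ₀t) = ≤-trans (conc-size (eval e s ρ) (eval e t ρ))
                                      (binary (size nl s) (size nl t) (go s Δ₀s) (go t Δ₀t))

-- simultaneous substitution; it is only applied to Δ₀-terms, so the
-- binders of iteration and recursion nodes are left untouched
sub : {U : Set} → (ℕ → Term U) → Term U → Term U
sub σ (var n)      = σ n
sub σ (const c)    = const c
sub σ (head t)     = head (sub σ t)
sub σ (tail t)     = tail (sub σ t)
sub σ (cons s t)   = cons (sub σ s) (sub σ t)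
sub σ (conc s t)   = conc (sub σ s) (sub σ t)
sub σ (iter i f h) = iter i f h
sub σ (rec f h t)  = rec f h t

_∷ˢ_ : {U : Set} → Term U → (ℕ → Term U) → ℕ → Term U
(s ∷ˢ σ) zero    = s
(s ∷ˢ σ) (suc n) = σ n

sub-eval : {U M : Set} (e : U → M) (σ : ℕ → Term U) (h : Term U) → IsΔ₀ h →
  (ρ ρ′ : Env M) → (∀ n → eval e (σ n) ρ ≡ ρ′ n) → eval e (sub σ h) ρ ≡ eval e h ρ′
sub-eval e σ (var n)    _           ρ ρ′ σ≡ = σ≡ n
sub-eval e σ (const c)  _           ρ ρ′ σ≡ = refl
sub-eval e σ (head t)   Δ₀t         ρ ρ′ σ≡ = cong headᴱ (sub-eval e σ t Δ₀t ρ ρ′ σ≡)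
sub-eval e σ (tail t)   Δ₀t         ρ ρ′ σ≡ = cong tailᴱ (sub-eval e σ t Δ₀t ρ ρ′ σ≡)
sub-eval e σ (cons s t) (Δ₀s , Δ₀t) ρ ρ′ σ≡ =
  cong₂ consᴱ (sub-eval e σ s Δ₀s ρ ρ′ σ≡) (sub-eval e σ t Δ₀t ρ ρ′ σ≡)
sub-eval e σ (conc s t) (Δ₀s , Δ₀t) ρ ρ′ σ≡ =
  cong₂ concᴱ (sub-eval e σ s Δ₀s ρ ρ′ σ≡) (sub-eval e σ t Δ₀t ρ ρ′ σ≡)

sub-Δ₀ : {U : Set} (σ : ℕ → Term U) (h : Term U) → IsΔ₀ h → (∀ n → IsΔ₀ (σ n)) → IsΔ₀ (sub σ h)
sub-Δ₀ σ (var n)    _           Δ₀σ = Δ₀σ n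
sub-Δ₀ σ (const c)  _           Δ₀σ = tt
sub-Δ₀ σ (head t)   Δ₀t         Δ₀σ = sub-Δ₀ σ t Δ₀t Δ₀σ
sub-Δ₀ σ (tail t)   Δ₀t         Δ₀σ = sub-Δ₀ σ t Δ₀t Δ₀σ
sub-Δ₀ σ (cons s t) (Δ₀s , Δ₀t) Δ₀σ = sub-Δ₀ σ s Δ₀s Δ₀σ , sub-Δ₀ σ t Δ₀t Δ₀σ
sub-Δ₀ σ (conc s t) (Δ₀s , Δ₀t) Δ₀σ = sub-Δ₀ σ s Δ₀s Δ₀σ , sub-Δ₀ σ t Δ₀t Δ₀σ

sub-size : {U : Set} (nl : ℕ → ℕ) (σ : ℕ → Term U) (h : Term U) → IsΔ₀ h → {K : ℕ} →
  (∀ n → size nl (σ n) ≤ K) → size nl (sub σ h) ≤ size nl h * K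
sub-size nl σ h Δ₀h {K} σ≤ = go h Δ₀h
  where
  open Scaled (≤-trans (size≥1 nl (σ 0)) (σ≤ 0))
  go : (h : Term _) → IsΔ₀ h → size nl (sub σ h) ≤ size nl h * K
  go (var n)    _           = leaf (σ≤ n)
  go (const c)  _           = constant (sizeHL c)
  go (head t)   Δ₀t         = unary (size nl t) (go t Δ₀t)
  go (tail t)   Δ₀t         = unary (size nl t) (go t Δ₀t)
  go (cons s t) (Δ₀s , Δ₀t) = binary (size nl s) (size nl t) (go s Δ₀s) (go t Δ₀t)
  go (conc s t) (Δ₀s , Δ₀t) = binary (size nl s) (size nl t) (go s Δ₀s) (go t Δ₀t)

unfoldIter : {U : Set} → ℕ → Term U → Term U → Term U
unfoldIter zero    f h = f
unfoldIter (suc i) f h = sub (unfoldIter i f h ∷ˢ var) h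

unfoldIter-eval : {U M : Set} (e : U → M) (i : ℕ) (f h : Term U) → IsΔ₀ h → (ρ : Env M) →
  eval e (unfoldIter i f h) ρ ≡ eval e (iter i f h) ρ
unfoldIter-eval e zero    f h Δ₀h ρ = refl
unfoldIter-eval e (suc i) f h Δ₀h ρ =
  trans (sub-eval e _ h Δ₀h ρ _ (λ { zero → refl ; (suc n) → refl }))
        (cong (λ y → eval e h (y ∷ᵉ ρ)) (unfoldIter-eval e i f h Δ₀h ρ))

unfoldIter-Δ₀ : {U : Set} (i : ℕ) (f h : Term U) → IsΔ₀ f → IsΔ₀ h → IsΔ₀ (unfoldIter i f h)
unfoldIter-Δ₀ zero    f h Δ₀f Δ₀h = Δ₀f
unfoldIter-Δ₀ (suc i) f h Δ₀f Δ₀h =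
  sub-Δ₀ _ h Δ₀h (λ { zero → unfoldIter-Δ₀ i f h Δ₀f Δ₀h ; (suc n) → tt })

-- each of the i substitutions multiplies the size by at most |h| < 2^|h|
unfoldIter-size : {U : Set} (nl : ℕ → ℕ) (i : ℕ) (f h : Term U) → IsΔ₀ h →
  size nl (unfoldIter i f h) ≤ 2 ^ (size nl h * i + size nl f)
unfoldIter-size nl zero f h Δ₀h =
  subst (λ x → size nl f ≤ 2 ^ (x + size nl f)) (sym (*-zeroʳ (size nl h))) (<⇒≤ (n<2^n (size nl f)))
unfoldIter-size nl (suc i) f h Δ₀h = begin
  size nl (unfoldIter (suc i) f h)   ≤⟨ sub-size nl _ h Δ₀h (λ { zero → ≤-refl ; (suc n) → size≥1 nl T }) ⟩
  H * size nl T                      ≤⟨ *-mono-≤ (<⇒≤ (n<2^n H)) (unfoldIter-size nl i f h Δ₀h) ⟩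
  2 ^ H * 2 ^ (H * i + size nl f)    ≡⟨ 2^-+ H (H * i + size nl f) ⟩
  2 ^ (H + (H * i + size nl f))      ≡⟨ cong (2 ^_) (regroup H i (size nl f)) ⟩
  2 ^ (H * suc i + size nl f)        ∎
  where
  open ≤-Reasoning
  T = unfoldIter i f h
  H = size nl h
  regroup : ∀ H i f → H + (H * i + f) ≡ H * suc i + f
  regroup = solve-∀

-- a Δ₀-term denoting the element b: the last element of the constant <b>
element : {U : Set} → El U → Term U
element b = head (const (snoc nil b))

unfoldRec : {U : Set} → Term U → Term U → HL U → Term U
unfoldRec f h nil        = f
unfoldRec f h (snoc α b) = sub (unfoldRec f h α ∷ˢ (element b ∷ˢ var)) h

unfoldRec-eval : {U M : Set} (e : U → M) (f h : Term U) → IsΔ₀ h → (ρ : Env M) (α : HL U) →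
  eval e (unfoldRec f h α) ρ ≡ recList (eval e f ρ) (λ y z → eval e h (y ∷ᵉ (z ∷ᵉ ρ))) (mapHL e α)
unfoldRec-eval e f h Δ₀h ρ nil        = refl
unfoldRec-eval e f h Δ₀h ρ (snoc α b) =
  trans (sub-eval e _ h Δ₀h ρ _ (λ { zero → refl ; (suc zero) → refl ; (suc (suc n)) → refl }))
        (cong (λ y → eval e h (y ∷ᵉ (mapEl e b ∷ᵉ ρ))) (unfoldRec-eval e f h Δ₀h ρ α))

unfoldRec-Δ₀ : {U : Set} (f h : Term U) → IsΔ₀ f → IsΔ₀ h → (α : HL U) → IsΔ₀ (unfoldRec f h α)
unfoldRec-Δ₀ f h Δ₀f Δ₀h nil        = Δ₀f
unfoldRec-Δ₀ f h Δ₀f Δ₀h (snoc α b) =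
  sub-Δ₀ _ h Δ₀h (λ { zero → unfoldRec-Δ₀ f h Δ₀f Δ₀h α ; (suc zero) → tt ; (suc (suc n)) → tt })

-- every element substitutes the current term and a term of size |b| + 6
unfoldRec-size : {U : Set} (f h : Term U) → IsΔ₀ h → (α : HL U) →
  size unaryLen (unfoldRec f h α) ≤ 2 ^ ((size unaryLen h + 3) * sizeHL α + size unaryLen f)
unfoldRec-size f h Δ₀h = growth (size unaryLen h) (size unaryLen f) (λ α → size unaryLen (unfoldRec f h α))
  (<⇒≤ (n<2^n (size unaryLen f)))
  (λ α b → sub-size unaryLen _ h Δ₀h (substituted α b))
  where
  substituted : ∀ α b → let T = size unaryLen (unfoldRec f h α) in
    ∀ n → size unaryLen ((unfoldRec f h α ∷ˢ (element b ∷ˢ var)) n) ≤ T + sizeEl b + 6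
  substituted α b zero          = ≤-trans (m≤m+n _ (sizeEl b)) (m≤m+n _ 6)
  substituted α b (suc zero)    = ≤-by (size unaryLen (unfoldRec f h α)) (rearrange _ (sizeEl b))
    where
    rearrange : ∀ T s → 3 + (2 + s + 1) + T ≡ T + s + 6
    rearrange = solve-∀
  substituted α b (suc (suc n)) =
    ≤-trans (size≥1 unaryLen (unfoldRec f h α)) (≤-trans (m≤m+n _ (sizeEl b)) (m≤m+n _ 6))

unfoldIters : {U : Set} → Term U → Term U
unfoldIters (var n)      = var n
unfoldIters (const c)    = const c
unfoldIters (head t)     = head (unfoldIters t)
unfoldIters (tail t)     = tail (unfoldIters t)
unfoldIters (cons s t)   = cons (unfoldIters s) (unfoldIters t)
unfoldIters (conc s t)   = conc (unfoldIters s) (unfoldIters t)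
unfoldIters (iter i f h) = unfoldIter i f h
unfoldIters (rec f h t)  = rec f h t

unfoldIters-eval : {U M : Set} (e : U → M) (t : Term U) → NoRec t → Flat t → (ρ : Env M) →
  eval e (unfoldIters t) ρ ≡ eval e t ρ
unfoldIters-eval e (var n)      _ _ ρ = refl
unfoldIters-eval e (const c)    _ _ ρ = refl
unfoldIters-eval e (head t)     nr fl ρ = cong headᴱ (unfoldIters-eval e t nr fl ρ)
unfoldIters-eval e (tail t)     nr fl ρ = cong tailᴱ (unfoldIters-eval e t nr fl ρ)
unfoldIters-eval e (cons s t) (nrs , nrt) (fls , flt) ρ =
  cong₂ consᴱ (unfoldIters-eval e s nrs fls ρ) (unfoldIters-eval e t nrt flt ρ)
unfoldIters-eval e (conc s t) (nrs , nrt) (fls , flt) ρ =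
  cong₂ concᴱ (unfoldIters-eval e s nrs fls ρ) (unfoldIters-eval e t nrt flt ρ)
unfoldIters-eval e (iter i f h) _ (_ , Δ₀h) ρ = unfoldIter-eval e i f h Δ₀h ρ

unfoldIters-Δ₀ : {U : Set} (t : Term U) → NoRec t → Flat t → IsΔ₀ (unfoldIters t)
unfoldIters-Δ₀ (var n)      _ _ = tt
unfoldIters-Δ₀ (const c)    _ _ = tt
unfoldIters-Δ₀ (head t)     nr fl = unfoldIters-Δ₀ t nr fl
unfoldIters-Δ₀ (tail t)     nr fl = unfoldIters-Δ₀ t nr fl
unfoldIters-Δ₀ (cons s t)   (nrs , nrt) (fls , flt) = unfoldIters-Δ₀ s nrs fls , unfoldIters-Δ₀ t nrt flt
unfoldIters-Δ₀ (conc s t)   (nrs , nrt) (fls , flt) = unfoldIters-Δ₀ s nrs fls , unfoldIters-Δ₀ t nrt flt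
unfoldIters-Δ₀ (iter i f h) _ (Δ₀f , Δ₀h) = unfoldIter-Δ₀ i f h Δ₀f Δ₀h

unfoldIters-size : {U : Set} (nl : ℕ → ℕ) {B : ℕ → ℕ} → SizeBound B →
  (∀ i (f h : Term U) → IsΔ₀ f → IsΔ₀ h → size nl (unfoldIter i f h) ≤ B (size nl (iter i f h))) →
  (t : Term U) → NoRec t → Flat t → size nl (unfoldIters t) ≤ B (size nl t)
unfoldIters-size nl {B} bound iter≤ = go
  where
  open SizeBound bound
  go : (t : Term _) → NoRec t → Flat t → size nl (unfoldIters t) ≤ B (size nl t)
  go (var n)      _ _ = n≤B 1
  go (const c)    _ _ = n≤B (sizeHL c)
  go (head t)     nr fl = unary-step (go t nr fl)
  go (tail t)     nr fl = unary-step (go t nr fl)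
  go (cons s t)   (nrs , nrt) (fls , flt) = binary-step (go s nrs fls) (go t nrt flt)
  go (conc s t)   (nrs , nrt) (fls , flt) = binary-step (go s nrs fls) (go t nrt flt)
  go (iter i f h) _ (Δ₀f , Δ₀h) = iter≤ i f h Δ₀f Δ₀h

unfoldIter-size-unary : {U : Set} (i : ℕ) (f h : Term U) → IsΔ₀ f → IsΔ₀ h →
  size unaryLen (unfoldIter i f h) ≤ rankBound 1 (size unaryLen (iter i f h))
unfoldIter-size-unary i f h _ Δ₀h = ≤-trans (unfoldIter-size unaryLen i f h Δ₀h)
  (2^-mono (≤-by (64 + i * i + F * F + H * H + 16 * i + 15 * F + 16 * H + 2 * i * F + i * H + 2 * F * H)
                 (square i F H)))
  where
  F = size unaryLen f
  H = size unaryLen h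
  square : ∀ i F H → H * i + F + (64 + i * i + F * F + H * H + 16 * i + 15 * F + 16 * H
                                    + 2 * i * F + i * H + 2 * F * H)
                   ≡ (8 + i + F + H) * (8 + i + F + H)
  square = solve-∀

-- with binary numerals i < 2^L for L digits, so it costs 2^(2^(n²))
unfoldIter-size-binary : {U : Set} (i : ℕ) (f h : Term U) → IsΔ₀ f → IsΔ₀ h →
  size binaryLen (unfoldIter i f h) ≤ rankBound 2 (size binaryLen (iter i f h))
unfoldIter-size-binary i f h _ Δ₀h = ≤-trans (unfoldIter-size binaryLen i f h Δ₀h) (2^-mono exponent)
  where
  open ≤-Reasoning
  F = size binaryLen f
  H = size binaryLen h
  L = binaryLen i
  square : ∀ L F H → H + F + L + (64 + L * L + F * F + H * H + 15 * L + 15 * F + 15 * H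
                                    + 2 * L * F + 2 * L * H + 2 * F * H)
                   ≡ (8 + L + F + H) * (8 + L + F + H)
  square = solve-∀
  exponent : H * i + F ≤ 2 ^ ((8 + L + F + H) * (8 + L + F + H))
  exponent = begin
    H * i + F                ≤⟨ +-mono-≤ (*-monoʳ-≤ H (<⇒≤ (<2^binaryLen i)))
                                         (Scaled.constant (1≤2^ L) F) ⟩
    H * 2 ^ L + F * 2 ^ L    ≡⟨ sym (*-distribʳ-+ (2 ^ L) H F) ⟩
    (H + F) * 2 ^ L          ≤⟨ *-monoˡ-≤ (2 ^ L) (<⇒≤ (n<2^n (H + F))) ⟩
    2 ^ (H + F) * 2 ^ L      ≡⟨ 2^-+ (H + F) L ⟩
    2 ^ (H + F + L)          ≤⟨ 2^-mono (≤-by (64 + L * L + F * F + H * H + 15 * L + 15 * F + 15 * H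
                                               + 2 * L * F + 2 * L * H + 2 * F * H) (square L F H)) ⟩
    2 ^ ((8 + L + F + H) * (8 + L + F + H)) ∎

nilEnv : {U : Set} → Env U
nilEnv _ = lst nil

valueOf : {U : Set} → Term U → HL U
valueOf t = asList (eval id t nilEnv)

valueOf-map : {U M : Set} (e : U → M) (t : Term U) → VariableFree t → (ρ : Env M) →
  asList (eval e t ρ) ≡ mapHL e (valueOf t)
valueOf-map e t vf ρ =
  trans (cong asList (eval-map e 0 t vf ρ nilEnv (λ _ ()))) (asList-map e (eval id t nilEnv))

unfoldRecs : {U : Set} → Term U → Term U
unfoldRecs (var n)      = var n
unfoldRecs (const c)    = const c
unfoldRecs (head t)     = head (unfoldRecs t)
unfoldRecs (tail t)     = tail (unfoldRecs t)
unfoldRecs (cons s t)   = cons (unfoldRecs s) (unfoldRecs t)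
unfoldRecs (conc s t)   = conc (unfoldRecs s) (unfoldRecs t)
unfoldRecs (iter i f h) = iter i f h
unfoldRecs (rec f h t)  = unfoldRec f h (valueOf t)

unfoldRecs-eval : {U M : Set} (e : U → M) (t : Term U) → NoIter t → Flat t → Explicit t →
  (ρ : Env M) → eval e (unfoldRecs t) ρ ≡ eval e t ρ
unfoldRecs-eval e (var n)    _ _ _ ρ = refl
unfoldRecs-eval e (const c)  _ _ _ ρ = refl
unfoldRecs-eval e (head t)   ni fl ex ρ = cong headᴱ (unfoldRecs-eval e t ni fl ex ρ)
unfoldRecs-eval e (tail t)   ni fl ex ρ = cong tailᴱ (unfoldRecs-eval e t ni fl ex ρ)
unfoldRecs-eval e (cons s t) (nis , nit) (fls , flt) (exs , ext) ρ =
  cong₂ consᴱ (unfoldRecs-eval e s nis fls exs ρ) (unfoldRecs-eval e t nit flt ext ρ)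
unfoldRecs-eval e (conc s t) (nis , nit) (fls , flt) (exs , ext) ρ =
  cong₂ concᴱ (unfoldRecs-eval e s nis fls exs ρ) (unfoldRecs-eval e t nit flt ext ρ)
unfoldRecs-eval e (rec f h t) _ (_ , Δ₀h , _) (_ , _ , _ , vf) ρ =
  trans (unfoldRec-eval e f h Δ₀h ρ (valueOf t))
        (cong (recList (eval e f ρ) (λ y z → eval e h (y ∷ᵉ (z ∷ᵉ ρ)))) (sym (valueOf-map e t vf ρ)))

unfoldRecs-Δ₀ : {U : Set} (t : Term U) → NoIter t → Flat t → IsΔ₀ (unfoldRecs t)
unfoldRecs-Δ₀ (var n)     _ _ = tt
unfoldRecs-Δ₀ (const c)   _ _ = tt
unfoldRecs-Δ₀ (head t)    ni fl = unfoldRecs-Δ₀ t ni fl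
unfoldRecs-Δ₀ (tail t)    ni fl = unfoldRecs-Δ₀ t ni fl
unfoldRecs-Δ₀ (cons s t)  (nis , nit) (fls , flt) = unfoldRecs-Δ₀ s nis fls , unfoldRecs-Δ₀ t nit flt
unfoldRecs-Δ₀ (conc s t)  (nis , nit) (fls , flt) = unfoldRecs-Δ₀ s nis fls , unfoldRecs-Δ₀ t nit flt
unfoldRecs-Δ₀ (rec f h t) _ (Δ₀f , Δ₀h , _) = unfoldRec-Δ₀ f h Δ₀f Δ₀h (valueOf t)

-- The value of t is also computed by its translation, a Δ₀-term, in an
-- environment of values of size 2; so it is at most twice as large.
valueOf-size : {U : Set} (t : Term U) → NoIter t → Flat t → Explicit t →
  sizeHL (valueOf t) ≤ 1 + size unaryLen (unfoldRecs t) * 2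
valueOf-size t ni fl ex = begin
  sizeHL (valueOf t)                       ≤⟨ asList-size (eval id t nilEnv) ⟩
  1 + sizeEl (eval id t nilEnv)            ≡⟨ cong (λ v → 1 + sizeEl v)
                                                  (sym (unfoldRecs-eval id t ni fl ex nilEnv)) ⟩
  1 + sizeEl (eval id (unfoldRecs t) nilEnv) ≤⟨ +-monoʳ-≤ 1 (value-size id unaryLen (unfoldRecs t)
                                                   (unfoldRecs-Δ₀ t ni fl) nilEnv (λ _ → ≤-refl)) ⟩
  1 + size unaryLen (unfoldRecs t) * 2     ∎
  where open ≤-Reasoning

unfoldRecs-size : {U : Set} (r : ℕ) (t : Term U) → NoIter t → Flat t → Explicit t → rank t ≤ r →
  size unaryLen (unfoldRecs t) ≤ rankBound r (size unaryLen t)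
unfoldRecs-size r (var n)    _ _ _ _ = RankBound.n≤B r 1
unfoldRecs-size r (const c)  _ _ _ _ = RankBound.n≤B r (sizeHL c)
unfoldRecs-size r (head t)   ni fl ex rk = RankBound.unary-step r (unfoldRecs-size r t ni fl ex rk)
unfoldRecs-size r (tail t)   ni fl ex rk = RankBound.unary-step r (unfoldRecs-size r t ni fl ex rk)
unfoldRecs-size r (cons s t) (nis , nit) (fls , flt) (exs , ext) rk =
  RankBound.binary-step r (unfoldRecs-size r s nis fls exs (m⊔n≤o⇒m≤o (rank s) (rank t) rk))
                          (unfoldRecs-size r t nit flt ext (m⊔n≤o⇒n≤o (rank s) (rank t) rk))
unfoldRecs-size r (conc s t) (nis , nit) (fls , flt) (exs , ext) rk =
  RankBound.binary-step r (unfoldRecs-size r s nis fls exs (m⊔n≤o⇒m≤o (rank s) (rank t) rk))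
                          (unfoldRecs-size r t nit flt ext (m⊔n≤o⇒n≤o (rank s) (rank t) rk))
unfoldRecs-size (suc r) (rec f h t) (_ , _ , nit) (_ , Δ₀h , flt) (_ , _ , ext , _) (s≤s rk) = begin
  size unaryLen (unfoldRec f h (valueOf t))   ≤⟨ unfoldRec-size f h Δ₀h (valueOf t) ⟩
  2 ^ ((H + 3) * sizeHL (valueOf t) + F)      ≤⟨ 2^-mono (+-monoˡ-≤ F (*-monoʳ-≤ (H + 3) value≤)) ⟩
  2 ^ ((H + 3) * (1 + rankBound r T * 2) + F) ≤⟨ 2^-mono (rec-exponent r F H T) ⟩
  rankBound (suc r) (size unaryLen (rec f h t)) ∎
  where
  open ≤-Reasoning
  F = size unaryLen f
  H = size unaryLen h
  T = size unaryLen t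
  value≤ : sizeHL (valueOf t) ≤ 1 + rankBound r T * 2
  value≤ = ≤-trans (valueOf-size t nit flt ext)
    (+-monoʳ-≤ 1 (*-monoˡ-≤ 2 (unfoldRecs-size r t nit flt ext
                                 (m⊔n≤o⇒n≤o (rank f ⊔ rank h) (rank t) rk))))

square : Poly
square = 0 ∷ 0 ∷ 1 ∷ []

evalPoly-square : ∀ n → evalPoly square n ≡ n * n
evalPoly-square = unfolded
  where
  unfolded : ∀ n → 0 + n * (0 + n * (1 + n * 0)) ≡ n * n
  unfolded = solve-∀

equivalent : {U : Set} (t t₀ : Term U) →
  (∀ {M} (e : U → M) (ρ : Env M) → eval e t₀ ρ ≡ eval e t ρ) → Equivalent t t₀
equivalent t t₀ agree M e _ ρ = sym (agree e (λ n → lst (ρ n)))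

squareBound : ∀ k n {x} → x ≤ exp k (n * n) → x ≤ exp k (evalPoly square n)
squareBound k n {x} = subst (λ m → x ≤ exp k m) (sym (evalPoly-square n))

iterations-eliminable : (U : Set) (t : Term U) → NoRec t → Flat t →
  (Σ[ t₀ ∈ Term U ]
    IsΔ₀ t₀ × Equivalent t t₀ × size unaryLen t₀ ≤ 2 ^ evalPoly square (size unaryLen t))
  ×
  (Σ[ t₀ ∈ Term U ]
    IsΔ₀ t₀ × Equivalent t t₀ × size binaryLen t₀ ≤ 2 ^ (2 ^ evalPoly square (size binaryLen t)))
iterations-eliminable U t nr fl =
    (unfoldIters t , Δ₀ , equiv , squareBound 1 (size unaryLen t)
      (unfoldIters-size unaryLen (rankBound-sizeBound 1) unfoldIter-size-unary t nr fl))
  , (unfoldIters t , Δ₀ , equiv , squareBound 2 (size binaryLen t)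
      (unfoldIters-size binaryLen (rankBound-sizeBound 2) unfoldIter-size-binary t nr fl))
  where
  Δ₀ = unfoldIters-Δ₀ t nr fl
  equiv = equivalent t (unfoldIters t) (λ e ρ → unfoldIters-eval e t nr fl ρ)

recursions-eliminable : (k : ℕ) → 1 ≤ k →
  (U : Set) (t : Term U) → NoIter t → Flat t → Explicit t → rank t ≤ k →
  Σ[ t₀ ∈ Term U ]
    IsΔ₀ t₀ × Equivalent t t₀ × size unaryLen t₀ ≤ exp k (evalPoly square (size unaryLen t))
recursions-eliminable k@(suc _) _ U t ni fl ex rk =
  unfoldRecs t , unfoldRecs-Δ₀ t ni fl
  , equivalent t (unfoldRecs t) (λ e ρ → unfoldRecs-eval e t ni fl ex ρ)
  , squareBound k (size unaryLen t) (unfoldRecs-size k t ni fl ex rk)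

lemma3 :
  (Σ[ p ∈ Poly ]
    ((U : Set) (t : Term U) → NoRec t → Flat t →
      (Σ[ t₀ ∈ Term U ]
        IsΔ₀ t₀ × Equivalent t t₀
        × size unaryLen t₀ ≤ 2 ^ evalPoly p (size unaryLen t))
      ×
      (Σ[ t₀ ∈ Term U ]
        IsΔ₀ t₀ × Equivalent t t₀
        × size binaryLen t₀ ≤ 2 ^ (2 ^ evalPoly p (size binaryLen t)))))
  ×
  ((k : ℕ) → 1 ≤ k →
    Σ[ p ∈ Poly ]
      ((U : Set) (t : Term U) → NoIter t → Flat t → Explicit t →
        rank t ≤ k →
        Σ[ t₀ ∈ Term U ]
          IsΔ₀ t₀ × Equivalent t t₀
          × size unaryLen t₀ ≤ exp k (evalPoly p (size unaryLen t))))
lemma3 = (square , iterations-eliminable) , λ k 1≤k → square , recursions-eliminable k 1≤k
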